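{- Let $\mathsf P$ be a Petri net. If an automorphism of a $\mathsf P$-graph fixes a node, then it is the identity on the connected component containing that node.
   Context: A Petri net is a diagram of finite sets $S\leftarrow I\to T\leftarrow O\to S$. A graph is a diagram of finite sets $A\leftarrow I_G\to N\leftarrow O_G\to A$ with injective outer maps; a morphism of such diagrams is etale if the two middle squares are pullbacks. A $\mathsf P$-graph is an etale map $p:\mathsf G\to\mathsf P$ from an acyclic graph $\mathsf G$; an automorphism of it is an automorphism of the graph $\mathsf G$ (bijections on $A,I_G,N,O_G$ compatible with the structure maps) commuting with $p$ on all four components. A graph is connected if it is non-empty and not a disjoint union of smaller non-empty graphs; the connected component of a node is the connected subgraph containing it. -}

module Defs where

open import Data.Nat using (ℕ)
open import Data.Fin using (Fin)
open import Data.Fin.Permutation using (Permutation′; _⟨$⟩ʳ_)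
open import Data.Product using (Σ; _×_; ∃)
open import Data.Sum using (_⊎_; inj₁; inj₂)
open import Relation.Nullary using (¬_)
open import Relation.Binary.PropositionalEquality using (_≡_)
open import Relation.Binary.Construct.Closure.Transitive using (TransClosure)
open import Relation.Binary.Construct.Closure.ReflexiveTransitive using (Star)
open import Relation.Binary.Construct.Closure.Symmetric using (SymClosure)
open import Function.Definitions using (Injective)

record PetriNet : Set where
  field
    S T I O : ℕ
    iS : Fin I → Fin S
    iT : Fin I → Fin T
    oT : Fin O → Fin T
    oS : Fin O → Fin S

record Graph : Set where
  field
    A I N O : ℕ
    iA : Fin I → Fin A
    iN : Fin I → Fin N
    oN : Fin O → Fin N
    oA : Fin O → Fin A
    iA-inj : Injective _≡_ _≡_ iA
    oA-inj : Injective _≡_ _≡_ oA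

-- The square  X → Y, X → Z, Z → W, Y → W  (commuting) is a pullback of finite sets:
-- the canonical map X → Y ×_W Z is a bijection.
IsPullback : ∀ {x y z w : ℕ}
  (f : Fin x → Fin y) (g : Fin x → Fin z) (h : Fin y → Fin w) (k : Fin z → Fin w) → Set
IsPullback {x} {y} {z} f g h k =
  ((b : Fin y) (c : Fin z) → h b ≡ k c → Σ (Fin x) (λ a → f a ≡ b × g a ≡ c))
  × ((a a′ : Fin x) → f a ≡ f a′ → g a ≡ g a′ → a ≡ a′)

record Etale (G : Graph) (P : PetriNet) : Set where
  open Graph G
  open PetriNet P renaming (I to IP; O to OP)
  field
    pA : Fin A → Fin S
    pI : Fin I → Fin IP
    pN : Fin N → Fin T
    pO : Fin O → Fin OP
    com-iS : ∀ x → iS (pI x) ≡ pA (iA x)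
    com-iT : ∀ x → iT (pI x) ≡ pN (iN x)
    com-oT : ∀ x → oT (pO x) ≡ pN (oN x)
    com-oS : ∀ x → oS (pO x) ≡ pA (oA x)
    pb-I : IsPullback iN pI pN iT
    pb-O : IsPullback oN pO pN oT

-- Directed edge between nodes: an output of n is (the same arc as) an input of m
Edge : (G : Graph) → Fin (Graph.N G) → Fin (Graph.N G) → Set
Edge G n m = let open Graph G in
  Σ (Fin O) λ o → Σ (Fin I) λ i → oN o ≡ n × iN i ≡ m × oA o ≡ iA i

Acyclic : Graph → Set
Acyclic G = ∀ n → ¬ TransClosure (Edge G) n n

record PAut {G : Graph} {P : PetriNet} (p : Etale G P) : Set where
  open Graph G
  open Etale p
  field
    σA : Permutation′ A
    σI : Permutation′ I
    σN : Permutation′ N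
    σO : Permutation′ O
    c-iA : ∀ x → iA (σI ⟨$⟩ʳ x) ≡ σA ⟨$⟩ʳ (iA x)
    c-iN : ∀ x → iN (σI ⟨$⟩ʳ x) ≡ σN ⟨$⟩ʳ (iN x)
    c-oN : ∀ x → oN (σO ⟨$⟩ʳ x) ≡ σN ⟨$⟩ʳ (oN x)
    c-oA : ∀ x → oA (σO ⟨$⟩ʳ x) ≡ σA ⟨$⟩ʳ (oA x)
    p-A : ∀ a → pA (σA ⟨$⟩ʳ a) ≡ pA a
    p-I : ∀ x → pI (σI ⟨$⟩ʳ x) ≡ pI x
    p-N : ∀ n → pN (σN ⟨$⟩ʳ n) ≡ pN n
    p-O : ∀ x → pO (σO ⟨$⟩ʳ x) ≡ pO x

Elt : Graph → Set
Elt G = let open Graph G in Fin A ⊎ Fin I ⊎ Fin N ⊎ Fin O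

arc : (G : Graph) → Fin (Graph.A G) → Elt G
arc G a = inj₁ a
inp : (G : Graph) → Fin (Graph.I G) → Elt G
inp G x = inj₂ (inj₁ x)
node : (G : Graph) → Fin (Graph.N G) → Elt G
node G n = inj₂ (inj₂ (inj₁ n))
out : (G : Graph) → Fin (Graph.O G) → Elt G
out G x = inj₂ (inj₂ (inj₂ x))

data Step (G : Graph) : Elt G → Elt G → Set where
  s-iA : ∀ x → Step G (inp G x) (arc G (Graph.iA G x))
  s-iN : ∀ x → Step G (inp G x) (node G (Graph.iN G x))
  s-oN : ∀ x → Step G (out G x) (node G (Graph.oN G x))
  s-oA : ∀ x → Step G (out G x) (arc G (Graph.oA G x))

-- y lies in the connected component of x: the equivalence relation generated by Step.
-- (Connected components of a diagram of sets are the classes of this relation.)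
SameComponent : (G : Graph) → Elt G → Elt G → Set
SameComponent G = Star (SymClosure (Step G))

act : {G : Graph} {P : PetriNet} {p : Etale G P} → PAut p → Elt G → Elt G
act α (inj₁ a) = inj₁ (PAut.σA α ⟨$⟩ʳ a)
act α (inj₂ (inj₁ x)) = inj₂ (inj₁ (PAut.σI α ⟨$⟩ʳ x))
act α (inj₂ (inj₂ (inj₁ n))) = inj₂ (inj₂ (inj₁ (PAut.σN α ⟨$⟩ʳ n)))
act α (inj₂ (inj₂ (inj₂ x))) = inj₂ (inj₂ (inj₂ (PAut.σO α ⟨$⟩ʳ x)))

{-# OPTIONS --safe #-}
-- An automorphism commutes with the structure maps, so its fixed elements are closed
-- under passing from an input or output to its arc and node.  They are also closed
-- under the converse steps: iA and oA are injective, and since the squares over P are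
-- pullbacks, an input (output) is determined by its node together with its image in P,
-- both of which the automorphism preserves.  Hence the fixed elements form a union of
-- connected components.
module Submission where

open import Defs
open import Level using (Level)
open import Data.Fin using (Fin)
open import Data.Fin.Permutation using (_⟨$⟩ʳ_)
open import Data.Sum.Properties using (inj₁-injective; inj₂-injective)
open import Data.Product using (proj₂)
open import Function.Base using (_∘_; flip)
open import Relation.Binary.Core using (Rel)
open import Relation.Binary.Definitions using (_Respects_)
open import Relation.Binary.PropositionalEquality using (_≡_; sym; trans; cong)
open import Relation.Binary.Construct.Closure.ReflexiveTransitive using (Star; ε; _◅_)
open import Relation.Binary.Construct.Closure.Symmetric using (SymClosure; fwd; bwd)

module _ {a ℓ p : Level} {A : Set a} {R : Rel A ℓ} {P : A → Set p} where

  SymClosure-respects : P Respects R → P Respects flip R → P Respects SymClosure R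
  SymClosure-respects resp resp⁻¹ (fwd r) = resp r
  SymClosure-respects resp resp⁻¹ (bwd r) = resp⁻¹ r

  Star-respects : P Respects R → P Respects Star R
  Star-respects resp ε        px = px
  Star-respects resp (r ◅ rs) px = Star-respects resp rs (resp r px)

module _ {P : PetriNet} {G : Graph} {p : Etale G P} (α : PAut p) where
  open Graph G
  open Etale p
  open PAut α

  Fixed : Elt G → Set
  Fixed e = act α e ≡ e

  private
    fixed-arc : ∀ {a} → Fixed (arc G a) → σA ⟨$⟩ʳ a ≡ a
    fixed-arc = inj₁-injective

    fixed-inp : ∀ {x} → Fixed (inp G x) → σI ⟨$⟩ʳ x ≡ x
    fixed-inp = inj₁-injective ∘ inj₂-injective

    fixed-node : ∀ {n} → Fixed (node G n) → σN ⟨$⟩ʳ n ≡ n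
    fixed-node = inj₁-injective ∘ inj₂-injective ∘ inj₂-injective

    fixed-out : ∀ {x} → Fixed (out G x) → σO ⟨$⟩ʳ x ≡ x
    fixed-out = inj₂-injective ∘ inj₂-injective ∘ inj₂-injective

  fixed-respects-Step : Fixed Respects Step G
  fixed-respects-Step (s-iA x) fx = cong (arc G)  (trans (sym (c-iA x)) (cong iA (fixed-inp fx)))
  fixed-respects-Step (s-iN x) fx = cong (node G) (trans (sym (c-iN x)) (cong iN (fixed-inp fx)))
  fixed-respects-Step (s-oN x) fx = cong (node G) (trans (sym (c-oN x)) (cong oN (fixed-out fx)))
  fixed-respects-Step (s-oA x) fx = cong (arc G)  (trans (sym (c-oA x)) (cong oA (fixed-out fx)))

  fixed-respects-Step⁻¹ : Fixed Respects flip (Step G)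
  fixed-respects-Step⁻¹ (s-iA x) fx = cong (inp G) (iA-inj (trans (c-iA x) (fixed-arc fx)))
  fixed-respects-Step⁻¹ (s-iN x) fx =
    cong (inp G) (proj₂ pb-I _ _ (trans (c-iN x) (fixed-node fx)) (p-I x))
  fixed-respects-Step⁻¹ (s-oN x) fx =
    cong (out G) (proj₂ pb-O _ _ (trans (c-oN x) (fixed-node fx)) (p-O x))
  fixed-respects-Step⁻¹ (s-oA x) fx = cong (out G) (oA-inj (trans (c-oA x) (fixed-arc fx)))

  fixed-respects-SameComponent : Fixed Respects SameComponent G
  fixed-respects-SameComponent =
    Star-respects (SymClosure-respects fixed-respects-Step fixed-respects-Step⁻¹)

lemma5p5 : (P : PetriNet) (G : Graph) (p : Etale G P) → Acyclic G →
    (α : PAut p) (v : Fin (Graph.N G)) → PAut.σN α ⟨$⟩ʳ v ≡ v →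
    (x : Elt G) → SameComponent G (node G v) x → act α x ≡ x
lemma5p5 P G p _ α v σv≡v x v~x = fixed-respects-SameComponent α v~x (cong (node G) σv≡v)
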